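{- Consider the rectangle with $5$ rows and $7$ columns, with unit squares labelled $(i,j)$, $i$ the row and $j$ the column. If a domino is removed whose two squares both lie in an even-numbered row, or both lie in an even-numbered column, then the remaining region cannot be tiled by right trominoes.
   Context: A right tromino is the L-shaped figure formed by three unit squares ($2\times 2$ square minus one unit square), in any rotation. A tiling of a region by right trominoes is a covering by grid-aligned copies with disjoint interiors. A domino is a pair of edge-adjacent unit squares. -}

module Defs where

open import Data.Nat using (ℕ; suc; _≤_)
open import Data.Nat.Divisibility using (_∣_)
open import Data.Nat.Properties using (_≟_)
open import Data.Product using (_×_; _,_)
open import Data.Product.Properties using (≡-dec)
open import Data.Sum using (_⊎_)
open import Data.Fin using (Fin; zero; suc)
open import Data.List using (List; []; _∷_; length; filter)
open import Data.List.Relation.Unary.All using (All)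
open import Data.List.Membership.DecPropositional (≡-dec _≟_ _≟_) using (_∈?_)
open import Relation.Binary.PropositionalEquality using (_≡_; _≢_)

-- A unit square (i , j): i = row, j = column, both 1-indexed.
Cell : Set
Cell = ℕ × ℕ

row col : Cell → ℕ
row (i , _) = i
col (_ , j) = j

InRect : Cell → Set
InRect (i , j) = (1 ≤ i × i ≤ 5) × (1 ≤ j × j ≤ 7)

Adjacent : Cell → Cell → Set
Adjacent (i , j) (i' , j') =
  ((i ≡ i') × (suc j ≡ j')) ⊎ ((i ≡ i') × (suc j' ≡ j)) ⊎
  ((j ≡ j') × (suc i ≡ i')) ⊎ ((j ≡ j') × (suc i' ≡ i))

-- A grid-aligned right tromino: the 2×2 block with top-left square (i , j),
-- minus one of its four squares (chosen by a Fin 4).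
record Tromino : Set where
  constructor tromino
  field
    corner  : Cell
    missing : Fin 4

cells : Tromino → List Cell
cells (tromino (i , j) zero)                   = (i , suc j) ∷ (suc i , j) ∷ (suc i , suc j) ∷ []
cells (tromino (i , j) (suc zero))             = (i , j) ∷ (suc i , j) ∷ (suc i , suc j) ∷ []
cells (tromino (i , j) (suc (suc zero)))       = (i , j) ∷ (i , suc j) ∷ (suc i , suc j) ∷ []
cells (tromino (i , j) (suc (suc (suc zero)))) = (i , j) ∷ (i , suc j) ∷ (suc i , j) ∷ []

coverCount : Cell → List Tromino → ℕ
coverCount c ts = length (filter (λ t → c ∈? cells t) ts)

-- A tiling of a region R by right trominoes: every tile lies inside R, and
-- every square of R is covered by exactly one tile (so tiles are disjoint).
Tiling : (Cell → Set) → Set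
Tiling R = Data.Product.Σ (List Tromino) λ ts →
  All (λ t → All R (cells t)) ts × (∀ c → R c → coverCount c ts ≡ 1)

RectMinus : Cell → Cell → Cell → Set
RectMinus a b c = InRect c × c ≢ a × c ≢ b

EvenRows EvenCols : Cell → Cell → Set
EvenRows a b = (2 ∣ row a) × (2 ∣ row b)
EvenCols a b = (2 ∣ col a) × (2 ∣ col b)

-- The twelve squares with both coordinates odd all survive the removal, since
-- the removed squares share an even row or an even column. A right tromino lies
-- in a 2 × 2 block, and every 2 × 2 block contains exactly one odd–odd square,
-- so a tiling needs at least 12 tiles, i.e. at least 36 squares. But the region
-- has at most 35 squares.
module Submission where

open import Defs
open import Algebra.Properties.CommutativeSemigroup using (interchange)
open import Data.Bool using (if_then_else_)
import Data.Fin as Fin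
open import Data.List
  using (List; []; _∷_; length; filter; map; applyUpTo; cartesianProduct; cartesianProductWith; allFin)
open import Data.List.Membership.Propositional using (_∈_)
open import Data.List.Membership.Propositional.Properties
  using (∈-applyUpTo⁺; ∈-cartesianProduct⁺; ∈-cartesianProductWith⁺; ∈-allFin)
open import Data.List.Properties using (map-cong; filter-none)
open import Data.List.Relation.Unary.All as All using (All; []; _∷_; all?)
open import Data.Nat using (ℕ; suc; _+_; _*_; _≤_; _≤?_; z≤n; s≤s)
open import Data.Nat.Divisibility using (_∣_; _∣?_)
open import Data.Nat.ListAction using (sum)
open import Data.Nat.Properties
  using (_≟_; +-mono-≤; ≤-reflexive; ≤-trans; *-identityʳ; *-monoˡ-≤; <-irrefl; +-commutativeSemigroup;
         module ≤-Reasoning)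
open import Data.Product using (_×_; _,_; proj₁; proj₂)
open import Data.Product.Properties using (≡-dec)
open import Data.Sum using (_⊎_; inj₁; inj₂)
open import Relation.Binary.PropositionalEquality
  using (_≡_; _≢_; refl; sym; cong; cong₂; module ≡-Reasoning)
open import Relation.Nullary using (¬_; Dec; yes; no; does; ¬?)
open import Relation.Nullary.Decidable using (_×-dec_; from-yes)
open import Relation.Unary using (Decidable)
open import Data.List.Membership.DecPropositional (≡-dec _≟_ _≟_) using (_∈?_)

module _ {A : Set} {P : A → Set} (P? : Decidable P) where

  indicator : A → ℕ
  indicator x = if does (P? x) then 1 else 0

  length-filter-∷ : ∀ y ys → length (filter P? (y ∷ ys)) ≡ indicator y + length (filter P? ys)
  length-filter-∷ y ys with P? y
  ... | yes _ = refl
  ... | no  _ = refl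

  length-filter≡sum-indicator : ∀ xs → length (filter P? xs) ≡ sum (map indicator xs)
  length-filter≡sum-indicator []       = refl
  length-filter≡sum-indicator (x ∷ xs) rewrite length-filter-∷ x xs =
    cong (indicator x +_) (length-filter≡sum-indicator xs)

module _ {A : Set} where

  sum-map-zero : ∀ (xs : List A) → sum (map (λ _ → 0) xs) ≡ 0
  sum-map-zero []       = refl
  sum-map-zero (_ ∷ xs) = sum-map-zero xs

  sum-map-+ : ∀ (f g : A → ℕ) xs → sum (map (λ x → f x + g x) xs) ≡ sum (map f xs) + sum (map g xs)
  sum-map-+ f g []       = refl
  sum-map-+ f g (x ∷ xs) rewrite sum-map-+ f g xs = interchange +-commutativeSemigroup (f x) (g x) _ _

  sum-map-≤ : ∀ {f : A → ℕ} {k xs} → All (λ x → f x ≤ k) xs → sum (map f xs) ≤ length xs * k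
  sum-map-≤ []         = z≤n
  sum-map-≤ (fx≤k ∷ p) = +-mono-≤ fx≤k (sum-map-≤ p)

  sum-map-≥ : ∀ {f : A → ℕ} {k xs} → All (λ x → k ≤ f x) xs → length xs * k ≤ sum (map f xs)
  sum-map-≥ []         = z≤n
  sum-map-≥ (k≤fx ∷ p) = +-mono-≤ k≤fx (sum-map-≥ p)

module _ {A B : Set} {R : A → B → Set} (R? : ∀ x y → Dec (R x y)) where

  double-counting : ∀ xs ys →
    sum (map (λ x → length (filter (R? x) ys)) xs) ≡ sum (map (λ y → length (filter (λ x → R? x y) xs)) ys)
  double-counting xs []       = sum-map-zero xs
  double-counting xs (y ∷ ys) = begin
    sum (map (λ x → length (filter (R? x) (y ∷ ys))) xs)
      ≡⟨ cong sum (map-cong (λ x → length-filter-∷ (R? x) y ys) xs) ⟩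
    sum (map (λ x → indicator (R? x) y + length (filter (R? x) ys)) xs)
      ≡⟨ sum-map-+ (λ x → indicator (R? x) y) (λ x → length (filter (R? x) ys)) xs ⟩
    sum (map (λ x → indicator (R? x) y) xs) + sum (map (λ x → length (filter (R? x) ys)) xs)
      ≡⟨ cong₂ _+_ (sym (length-filter≡sum-indicator (λ x → R? x y) xs)) (double-counting xs ys) ⟩
    length (filter (λ x → R? x y) xs) + sum (map (λ y → length (filter (λ x → R? x y) xs)) ys)
      ∎
    where open ≡-Reasoning

_≟ᶜ_ : (c d : Cell) → Dec (c ≡ d)
_≟ᶜ_ = ≡-dec _≟_ _≟_

InRect? : Decidable InRect
InRect? (i , j) = ((1 ≤? i) ×-dec (i ≤? 5)) ×-dec ((1 ≤? j) ×-dec (j ≤? 7))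

RectMinus? : ∀ a b → Decidable (RectMinus a b)
RectMinus? a b c = InRect? c ×-dec ¬? (c ≟ᶜ a) ×-dec ¬? (c ≟ᶜ b)

coveredBy : List Cell → Tromino → ℕ
coveredBy L t = length (filter (_∈? cells t) L)

coverCount-outside : ∀ {R : Cell → Set} {c} ts → All (λ t → All R (cells t)) ts → ¬ R c → coverCount c ts ≡ 0
coverCount-outside {c = c} ts inside ¬Rc =
  cong length (filter-none (λ t → c ∈? cells t) (All.map (λ inR c∈t → ¬Rc (All.lookup inR c∈t)) inside))

coverCount≤1 : ∀ {R : Cell → Set} → Decidable R → (T : Tiling R) → ∀ c → coverCount c (proj₁ T) ≤ 1
coverCount≤1 R? (ts , inside , exact) c with R? c
... | yes Rc = ≤-reflexive (exact c Rc)
... | no ¬Rc = ≤-trans (≤-reflexive (coverCount-outside ts inside ¬Rc)) z≤n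

tiling-length-≥ : ∀ {R : Cell → Set} (T : Tiling R) {L} →
  All R L → All (λ t → coveredBy L t ≤ 1) (proj₁ T) → length L ≤ length (proj₁ T)
tiling-length-≥ (ts , _ , exact) {L} L⊆R few = begin
  length L                                ≡⟨ sym (*-identityʳ (length L)) ⟩
  length L * 1                            ≤⟨ sum-map-≥ (All.map (λ {c} Rc → ≤-reflexive (sym (exact c Rc))) L⊆R) ⟩
  sum (map (λ c → coverCount c ts) L)     ≡⟨ double-counting (λ c t → c ∈? cells t) L ts ⟩
  sum (map (coveredBy L) ts)              ≤⟨ sum-map-≤ few ⟩
  length ts * 1                           ≡⟨ *-identityʳ (length ts) ⟩
  length ts                               ∎
  where open ≤-Reasoning

tiling-length-≤ : ∀ {R : Cell → Set} → Decidable R → (T : Tiling R) → ∀ {L k} →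
  All (λ t → k ≤ coveredBy L t) (proj₁ T) → length (proj₁ T) * k ≤ length L
tiling-length-≤ R? T@(ts , _ , _) {L} {k} many = begin
  length ts * k                           ≤⟨ sum-map-≥ many ⟩
  sum (map (coveredBy L) ts)              ≡⟨ sym (double-counting (λ c t → c ∈? cells t) L ts) ⟩
  sum (map (λ c → coverCount c ts) L)     ≤⟨ sum-map-≤ (All.universal (coverCount≤1 R? T) L) ⟩
  length L * 1                            ≡⟨ *-identityʳ (length L) ⟩
  length L                                ∎
  where open ≤-Reasoning

rectangle : List Cell
rectangle = cartesianProduct (applyUpTo suc 5) (applyUpTo suc 7)

oddSquares : List Cell
oddSquares = cartesianProduct (applyUpTo (λ k → 1 + 2 * k) 3) (applyUpTo (λ k → 1 + 2 * k) 4)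

rectTrominoes : List Tromino
rectTrominoes = cartesianProductWith tromino (cartesianProduct (applyUpTo suc 4) (applyUpTo suc 6)) (allFin 4)

OddOdd : Cell → Set
OddOdd c = ¬ 2 ∣ row c × ¬ 2 ∣ col c

oddSquares-odd : All (λ c → InRect c × OddOdd c) oddSquares
oddSquares-odd = from-yes (all? (λ c → InRect? c ×-dec ¬? (2 ∣? row c) ×-dec ¬? (2 ∣? col c)) oddSquares)

rectTrominoes-counts : All (λ t → coveredBy oddSquares t ≤ 1 × 3 ≤ coveredBy rectangle t) rectTrominoes
rectTrominoes-counts =
  from-yes (all? (λ t → (coveredBy oddSquares t ≤? 1) ×-dec (3 ≤? coveredBy rectangle t)) rectTrominoes)

corner-bounds : ∀ i j m → All InRect (cells (tromino (i , j) m)) → (1 ≤ i × i ≤ 4) × (1 ≤ j × j ≤ 6)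
corner-bounds i j Fin.zero
  (((1≤i , _) , (_ , s≤s j≤6)) ∷ ((_ , s≤s i≤4) , (1≤j , _)) ∷ _) = (1≤i , i≤4) , (1≤j , j≤6)
corner-bounds i j (Fin.suc Fin.zero)
  (((1≤i , _) , (1≤j , _)) ∷ ((_ , s≤s i≤4) , _) ∷ (_ , (_ , s≤s j≤6)) ∷ _) = (1≤i , i≤4) , (1≤j , j≤6)
corner-bounds i j (Fin.suc (Fin.suc Fin.zero))
  (((1≤i , _) , (1≤j , _)) ∷ (_ , (_ , s≤s j≤6)) ∷ ((_ , s≤s i≤4) , _) ∷ _) = (1≤i , i≤4) , (1≤j , j≤6)
corner-bounds i j (Fin.suc (Fin.suc (Fin.suc Fin.zero)))
  (((1≤i , _) , (1≤j , _)) ∷ (_ , (_ , s≤s j≤6)) ∷ ((_ , s≤s i≤4) , _) ∷ _) = (1≤i , i≤4) , (1≤j , j≤6)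

∈-rectTrominoes : ∀ t → All InRect (cells t) → t ∈ rectTrominoes
∈-rectTrominoes (tromino (i , j) m) inRect with corner-bounds i j m inRect
... | (s≤s z≤n , i≤4) , (s≤s z≤n , j≤6) =
  ∈-cartesianProductWith⁺ tromino
    (∈-cartesianProduct⁺ (∈-applyUpTo⁺ suc i≤4) (∈-applyUpTo⁺ suc j≤6)) (∈-allFin m)

odd-∉-domino : ∀ {a b c} → OddOdd c → EvenRows a b ⊎ EvenCols a b → c ≢ a × c ≢ b
odd-∉-domino (odd-row , _) (inj₁ (even-a , even-b)) = (λ { refl → odd-row even-a }) , (λ { refl → odd-row even-b })
odd-∉-domino (_ , odd-col) (inj₂ (even-a , even-b)) = (λ { refl → odd-col even-a }) , (λ { refl → odd-col even-b })

lemma2 : (a b : Cell) → InRect a → InRect b → Adjacent a b →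
    EvenRows a b ⊎ EvenCols a b → ¬ Tiling (RectMinus a b)
lemma2 a b _ _ _ parity T@(ts , inside , _) = <-irrefl refl (≤-trans (*-monoˡ-≤ 3 12≤tiles) tiles*3≤35)
  where
  counts : All (λ t → coveredBy oddSquares t ≤ 1 × 3 ≤ coveredBy rectangle t) ts
  counts = All.map (λ t⊆R → All.lookup rectTrominoes-counts (∈-rectTrominoes _ (All.map proj₁ t⊆R))) inside

  oddSquares⊆R : All (RectMinus a b) oddSquares
  oddSquares⊆R = All.map (λ (inRect , odd) → inRect , odd-∉-domino odd parity) oddSquares-odd

  12≤tiles : 12 ≤ length ts
  12≤tiles = tiling-length-≥ T oddSquares⊆R (All.map proj₁ counts)

  tiles*3≤35 : length ts * 3 ≤ 35
  tiles*3≤35 = tiling-length-≤ (RectMinus? a b) T (All.map proj₂ counts)
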